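{- Let $X$ be a weighted pure $n$-dimensional simplicial complex and $0\le k\le n-1$. For every $\phi\in C^k(X,\mathbb{F}_2)$ and every $\varepsilon>0$ there is $\psi\in C^{k-1}(X,\mathbb{F}_2)$ such that $\phi-d\psi$ is $\varepsilon$-locally minimal and $\|\phi\|\ge\|\phi-d\psi\|+\varepsilon\|\psi\|$.
   Context: $X$ is finite, $X^{(k)}$ its $k$-simplices ($X^{(-1)}=\{\emptyset\}$). A weight is $m:\bigcup_kX^{(k)}\to(0,\infty)$ with $m(\tau)=\sum_{\sigma\in X^{(k+1)},\tau\subset\sigma}m(\sigma)$; $m(U)=\sum_{\sigma\in U}m(\sigma)$. $C^k(Y,\mathbb{F}_2)$ = functions $Y^{(k)}\to\mathbb{F}_2$ (for $k=-1$, functions on $\{\emptyset\}$), norm $\|\phi\|=\sum_{\phi(\tau)=1}m(\tau)$, differential $(d\phi)(\sigma)=\sum_{\tau\in Y^{(k)},\tau\subset\sigma}\phi(\tau)$ mod 2 (so for $\psi\in C^{ -1}$, $d\psi$ is the constant $\psi(\emptyset)$); $B^k=d(C^{k-1})$. Link $X_\tau$ ($\tau\in X^{(j)}$): simplices disjoint from $\tau$ with union in $X$, weight $m_\tau(\sigma)=m(\tau\cup\sigma)$, norms computed with $m_\tau$; localization $\phi_\tau(\sigma)=\phi(\tau\cup\sigma)$. For $k\ge1$, $\phi\in C^k$ is $\varepsilon$-locally minimal if for all $0\le j\le k-1$, $\tau\in X^{(j)}$, $\varphi\in B^{k-j-1}(X_\tau,\mathbb{F}_2)$: $\|\phi_\tau\|\le\|\phi_\tau-\varphi\|+\varepsilon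 m(\tau)$; $\phi\in C^0$ is $\varepsilon$-locally minimal if $\|\phi\|\le(1+\varepsilon)m(X^{(0)})/2$. -}

module Defs where

open import Level using (Level; _⊔_) renaming (suc to lsuc)
open import Data.Bool using (Bool; true; false; _∧_; _xor_; if_then_else_)
open import Data.Nat using (ℕ; zero; suc; _≤_; _<_; _∸_; _≡ᵇ_)
open import Data.Product using (Σ; ∃; _×_)
open import Data.List using (List; []; _∷_; _++_; map; foldr)
open import Data.Vec using (Vec; []; _∷_)
open import Data.Fin.Subset using (Subset; _⊆_; _∪_; ∣_∣) renaming (⊥ to ∅)
open import Data.Fin.Subset.Properties using (_⊆?_)
open import Relation.Nullary using (¬_)
open import Relation.Nullary.Decidable using (⌊_⌋)
open import Relation.Binary.PropositionalEquality using (_≡_)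
open import Relation.Binary.Structures using (IsTotalOrder)
open import Algebra.Bundles using (CommutativeRing)

-- Scalars: an ordered field (the real numbers are one; the paper uses ℝ)

record OrderedField (c ℓ : Level) : Set (lsuc (c ⊔ ℓ)) where
  field
    commutativeRing : CommutativeRing c ℓ
  open CommutativeRing commutativeRing public
  field
    _≤F_         : Carrier → Carrier → Set ℓ
    isTotalOrder : IsTotalOrder _≈_ _≤F_
    +-mono-≤F    : ∀ {x y} z → x ≤F y → (x + z) ≤F (y + z)
    *-nonneg     : ∀ {x y} → 0# ≤F x → 0# ≤F y → 0# ≤F (x * y)
    0≉1          : ¬ (0# ≈ 1#)
    inverse      : ∀ x → ¬ (x ≈ 0#) → ∃ λ y → (x * y) ≈ 1#

  _<F_ : Carrier → Carrier → Set ℓ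
  x <F y = (x ≤F y) × ¬ (x ≈ y)

allSubsets : (N : ℕ) → List (Subset N)
allSubsets zero    = [] ∷ []
allSubsets (suc N) = map (true ∷_) (allSubsets N) ++ map (false ∷_) (allSubsets N)

_⊆ᵇ_ : ∀ {N} → Subset N → Subset N → Bool
s ⊆ᵇ t = ⌊ s ⊆? t ⌋

disjointᵇ : ∀ {N} → Subset N → Subset N → Bool
disjointᵇ []      []      = true
disjointᵇ (true ∷ s) (true ∷ t) = false
disjointᵇ (true ∷ s) (false ∷ t) = disjointᵇ s t
disjointᵇ (false ∷ s) (_ ∷ t) = disjointᵇ s t

xorOver : ∀ {N} → (Subset N → Bool) → (Subset N → Bool) → Bool
xorOver {N} P f = foldr (λ s acc → if P s then f s xor acc else acc) false (allSubsets N)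

-- Simplicial complexes on vertex set Fin N, given by their set of faces
-- (a Boolean membership predicate; the empty simplex is included).

Complex : ℕ → Set
Complex N = Subset N → Bool

-- X^(k) consists of the faces of cardinality k+1
IsSimplicialComplex : ∀ {N} → Complex N → Set
IsSimplicialComplex X = (X ∅ ≡ true) × (∀ s t → s ⊆ t → X t ≡ true → X s ≡ true)

IsPure : ∀ {N} → ℕ → Complex N → Set
IsPure {N} n X = ∀ s → X s ≡ true → (∣ s ∣ ≤ suc n) × (Σ (Subset N) λ t → (s ⊆ t) × (X t ≡ true) × (∣ t ∣ ≡ suc n))

-- k-cochains with F₂ coefficients: functions on faces (only their values on
-- faces of the relevant cardinality matter)
Cochain : ℕ → Set
Cochain N = Subset N → Bool

_⊖_ : ∀ {N} → Cochain N → Cochain N → Cochain N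
(φ ⊖ ψ) s = φ s xor ψ s

-- differential: from cochains on faces of cardinality j to faces of cardinality j+1
-- (j = 0 is C^{-1} → C^0, giving the constant ψ(∅))
d : ∀ {N} → Complex N → ℕ → Cochain N → Cochain N
d Y j φ σ = xorOver (λ τ → Y τ ∧ (∣ τ ∣ ≡ᵇ j) ∧ (τ ⊆ᵇ σ)) φ

link : ∀ {N} → Complex N → Subset N → Complex N
link X τ σ = disjointᵇ τ σ ∧ X (τ ∪ σ)

loc : ∀ {N} → Subset N → Cochain N → Cochain N
loc τ φ σ = φ (τ ∪ σ)

module _ {c ℓ} (F : OrderedField c ℓ) where
  open OrderedField F

  Weight : ℕ → Set c
  Weight N = Subset N → Carrier

  sumOver : ∀ {N} → (Subset N → Bool) → (Subset N → Carrier) → Carrier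
  sumOver {N} P f = foldr (λ s acc → if P s then f s + acc else acc) 0# (allSubsets N)

  IsWeight : ∀ {N} → ℕ → Complex N → Weight N → Set ℓ
  IsWeight n X m =
    (∀ τ → X τ ≡ true → 0# <F m τ) ×
    (∀ τ → X τ ≡ true → ∣ τ ∣ ≤ n →
       m τ ≈ sumOver (λ σ → X σ ∧ (∣ σ ∣ ≡ᵇ suc ∣ τ ∣) ∧ (τ ⊆ᵇ σ)) m)

  norm : ∀ {N} → Complex N → Weight N → ℕ → Cochain N → Carrier
  norm Y w j φ = sumOver (λ s → Y s ∧ (∣ s ∣ ≡ᵇ j) ∧ φ s) w

  linkWeight : ∀ {N} → Weight N → Subset N → Weight N
  linkWeight m τ σ = m (τ ∪ σ)

  -- ε-local minimality of a k-cochain φ (k = degree; φ lives on faces of cardinality k+1)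
  LocallyMinimal : ∀ {N} → Complex N → Weight N → Carrier → ℕ → Cochain N → Set ℓ
  LocallyMinimal X m ε zero φ =
    -- ‖φ‖ ≤ (1+ε) m(X^(0)) / 2, written without division
    ((1# + 1#) * norm X m 1 φ) ≤F ((1# + ε) * sumOver (λ s → X s ∧ (∣ s ∣ ≡ᵇ 1)) m)
  LocallyMinimal {N} X m ε (suc k) φ =
    ∀ (j : ℕ) (τ : Subset N) (χ : Cochain N) → j ≤ k → X τ ≡ true → ∣ τ ∣ ≡ suc j →
      -- φ_τ ∈ C^{k-j}(X_τ) lives on faces of cardinality (suc k ∸ j);
      -- d χ with χ ∈ C^{k-j-1}(X_τ) ranges over B^{k-j}(X_τ)
      norm (link X τ) (linkWeight m τ) (suc k ∸ j) (loc τ φ)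
        ≤F (norm (link X τ) (linkWeight m τ) (suc k ∸ j)
              (loc τ φ ⊖ d (link X τ) (k ∸ j) χ)
            + ε * m τ)

module Submission where

-- Since there are finitely many cochains, some ψ minimises the energy ‖φ - dψ‖ + ε‖ψ‖;
-- comparing with ψ = 0 gives the inequality. If φ - dψ were not ε-locally minimal at a
-- face τ, witnessed by dχ on the link of τ, then replacing ψ by ψ + χ̃, where χ̃ extends χ
-- by zero from the star of τ, would change φ - dψ only on the star of τ, lowering its norm
-- there by more than ε m(τ), while ‖χ̃‖ ≤ m(τ) because the faces of any fixed dimension in
-- the star of τ have total weight at most m(τ). This contradicts minimality. In degree 0
-- the same argument applies with τ = ∅ and χ ≡ 1.

open import Defs
open import Algebra.Bundles using (CommutativeMonoid; CommutativeRing)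
open import Data.Bool using (Bool; true; false; not; _∧_; _xor_; if_then_else_; T)
open import Data.Bool.Properties
  using (xor-∧-commutativeRing; T-≡; ∧-zeroʳ; xor-assoc; xor-identityʳ; xor-comm; true-xor)
open import Data.Fin.Subset using (Subset; _⊆_; _∪_; _─_; ∣_∣) renaming (⊥ to ∅)
open import Data.Fin.Subset.Properties
  using (_⊆?_; ⊆-refl; ⊆-trans; ⊥⊆; p⊆q⇒∣p∣≤∣q∣; ∣⊥∣≡0; ∪-identityˡ)
open import Data.List using (List; []; _∷_; _++_; map; foldr; cartesianProductWith)
open import Data.List.Membership.Propositional using (_∈_)
open import Data.List.Membership.Propositional.Properties using (∈-cartesianProductWith⁺)
open import Data.List.Relation.Unary.Any using (here; there)
open import Data.List.Relation.Unary.All using (lookup)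
open import Data.Nat using (ℕ; zero; suc; _∸_; _≤_; _<_; z≤n; s≤s; _≡ᵇ_)
import Data.Nat as ℕ
import Data.Nat.Properties as ℕₚ
open import Data.Product using (Σ; _×_; _,_; proj₁; proj₂)
open import Data.Vec using ([]; _∷_)
open import Data.Vec.Properties using (∷-injectiveʳ)
open import Function using (_∘_)
open import Function.Bundles using (Equivalence)
open import Relation.Binary.PropositionalEquality as ≡ using (_≡_; _≢_; _≗_)
open import Relation.Nullary using (does; yes; no; contradiction)
open import Relation.Nullary.Decidable using (isYes≗does)

private variable N : ℕ

∧≡true⁻ : ∀ {a b} → a ∧ b ≡ true → (a ≡ true) × (b ≡ true)
∧≡true⁻ {true} b≡true = ≡.refl , b≡true

≡ᵇ⇒≡ : ∀ x y → (x ≡ᵇ y) ≡ true → x ≡ y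
≡ᵇ⇒≡ x y eq = ℕₚ.≡ᵇ⇒≡ x y (≡.subst T (≡.sym eq) _)

≡⇒≡ᵇ : ∀ {x y} → x ≡ y → (x ≡ᵇ y) ≡ true
≡⇒≡ᵇ {x} ≡.refl = Equivalence.to T-≡ (ℕₚ.≡⇒≡ᵇ x x ≡.refl)

≡ᵇ-+ˡ : ∀ a x y → (a ℕ.+ x ≡ᵇ a ℕ.+ y) ≡ (x ≡ᵇ y)
≡ᵇ-+ˡ zero    x y = ≡.refl
≡ᵇ-+ˡ (suc a) x y = ≡ᵇ-+ˡ a x y

-- Subsets

-- `_⊆ᵇ_` does not reduce on cons cells, but `does` of the same decision does; `⊆ᵇ≡⊑`
-- converts between them.
infix 7 _⊑_

_⊑_ : Subset N → Subset N → Bool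
p ⊑ q = does (p ⊆? q)

⊆ᵇ≡⊑ : (p q : Subset N) → (p ⊆ᵇ q) ≡ (p ⊑ q)
⊆ᵇ≡⊑ p q = isYes≗does (p ⊆? q)

⊑⇒⊆ : (p q : Subset N) → p ⊑ q ≡ true → p ⊆ q
⊑⇒⊆ p q p⊑q with p ⊆? q
... | yes p⊆q = p⊆q
⊑⇒⊆ _ _ () | no _

⊆⇒⊑ : (p q : Subset N) → p ⊆ q → p ⊑ q ≡ true
⊆⇒⊑ p q p⊆q with p ⊆? q
... | yes _   = ≡.refl
... | no p⊈q  = contradiction (λ {x} → p⊆q {x}) p⊈q

⊑-refl : (p : Subset N) → p ⊑ p ≡ true
⊑-refl p = ⊆⇒⊑ p p ⊆-refl

⊑-trans : (p q r : Subset N) → p ⊑ q ≡ true → q ⊑ r ≡ true → p ⊑ r ≡ true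
⊑-trans p q r p⊑q q⊑r = ⊆⇒⊑ p r (⊆-trans (⊑⇒⊆ p q p⊑q) (⊑⇒⊆ q r q⊑r))

∅⊑ : (p : Subset N) → ∅ ⊑ p ≡ true
∅⊑ p = ⊆⇒⊑ ∅ p ⊥⊆

∣p∣≡0⇒p≡∅ : (p : Subset N) → ∣ p ∣ ≡ 0 → p ≡ ∅
∣p∣≡0⇒p≡∅ []          _  = ≡.refl
∣p∣≡0⇒p≡∅ (false ∷ p) eq = ≡.cong (false ∷_) (∣p∣≡0⇒p≡∅ p eq)

disjoint-∅ : (p : Subset N) → disjointᵇ ∅ p ≡ true
disjoint-∅ []      = ≡.refl
disjoint-∅ (_ ∷ p) = disjoint-∅ p

⊑∧∣∣≡⇒≡ : (p q : Subset N) → p ⊑ q ≡ true → ∣ q ∣ ≡ ∣ p ∣ → q ≡ p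
⊑∧∣∣≡⇒≡ []          []          _   _  = ≡.refl
⊑∧∣∣≡⇒≡ (true ∷ p)  (true ∷ q)  p⊑q eq = ≡.cong (true ∷_) (⊑∧∣∣≡⇒≡ p q p⊑q (ℕₚ.suc-injective eq))
⊑∧∣∣≡⇒≡ (false ∷ p) (false ∷ q) p⊑q eq = ≡.cong (false ∷_) (⊑∧∣∣≡⇒≡ p q p⊑q eq)
⊑∧∣∣≡⇒≡ (false ∷ p) (true ∷ q)  p⊑q eq =
  contradiction (≡.subst (_≤ ∣ q ∣) (≡.sym eq) (p⊆q⇒∣p∣≤∣q∣ (⊑⇒⊆ p q p⊑q))) ℕₚ.1+n≰n

⊑-intermediate : (p q : Subset N) → p ⊑ q ≡ true → ∣ p ∣ < ∣ q ∣ →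
  Σ (Subset N) λ r → (p ⊑ r ≡ true) × (r ⊑ q ≡ true) × (∣ r ∣ ≡ suc ∣ p ∣)
⊑-intermediate (true ∷ p) (true ∷ q) p⊑q (s≤s ∣p∣<∣q∣) with ⊑-intermediate p q p⊑q ∣p∣<∣q∣
... | r , p⊑r , r⊑q , ∣r∣ = true ∷ r , p⊑r , r⊑q , ≡.cong suc ∣r∣
⊑-intermediate (false ∷ p) (false ∷ q) p⊑q ∣p∣<∣q∣ with ⊑-intermediate p q p⊑q ∣p∣<∣q∣
... | r , p⊑r , r⊑q , ∣r∣ = false ∷ r , p⊑r , r⊑q , ∣r∣
⊑-intermediate (false ∷ p) (true ∷ q) p⊑q _ = true ∷ p , ⊑-refl p , p⊑q , ≡.refl

∣∪∣-disjoint : (τ ρ : Subset N) → disjointᵇ τ ρ ≡ true → ∣ τ ∪ ρ ∣ ≡ ∣ τ ∣ ℕ.+ ∣ ρ ∣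
∣∪∣-disjoint []          []          _ = ≡.refl
∣∪∣-disjoint (true ∷ τ)  (false ∷ ρ) d = ≡.cong suc (∣∪∣-disjoint τ ρ d)
∣∪∣-disjoint (false ∷ τ) (false ∷ ρ) d = ∣∪∣-disjoint τ ρ d
∣∪∣-disjoint (false ∷ τ) (true ∷ ρ)  d = ≡.trans (≡.cong suc (∣∪∣-disjoint τ ρ d)) (≡.sym (ℕₚ.+-suc ∣ τ ∣ ∣ ρ ∣))

∪─-disjoint : (τ ρ : Subset N) → disjointᵇ τ ρ ≡ true → (τ ∪ ρ) ─ τ ≡ ρ
∪─-disjoint []          []          _ = ≡.refl
∪─-disjoint (true ∷ τ)  (false ∷ ρ) d = ≡.cong (false ∷_) (∪─-disjoint τ ρ d)
∪─-disjoint (false ∷ τ) (b ∷ ρ)     d = ≡.cong (b ∷_) (∪─-disjoint τ ρ d)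

∪⊑∪-disjoint : (τ ρ ρ′ : Subset N) → disjointᵇ τ ρ ≡ true → disjointᵇ τ ρ′ ≡ true →
  (τ ∪ ρ) ⊑ (τ ∪ ρ′) ≡ ρ ⊑ ρ′
∪⊑∪-disjoint []          []          []           _ _ = ≡.refl
∪⊑∪-disjoint (true ∷ τ)  (false ∷ ρ) (false ∷ ρ′) d d′ = ∪⊑∪-disjoint τ ρ ρ′ d d′
∪⊑∪-disjoint (false ∷ τ) (false ∷ ρ) (_ ∷ ρ′)     d d′ = ∪⊑∪-disjoint τ ρ ρ′ d d′
∪⊑∪-disjoint (false ∷ τ) (true ∷ ρ)  (true ∷ ρ′)  d d′ = ∪⊑∪-disjoint τ ρ ρ′ d d′
∪⊑∪-disjoint (false ∷ τ) (true ∷ ρ)  (false ∷ ρ′) d d′ = ≡.refl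

∣∪∣≡ᵇ-disjoint : (τ ρ : Subset N) (l : ℕ) → disjointᵇ τ ρ ≡ true → (∣ τ ∪ ρ ∣ ≡ᵇ l ℕ.+ ∣ τ ∣) ≡ (∣ ρ ∣ ≡ᵇ l)
∣∪∣≡ᵇ-disjoint τ ρ l d = begin
  ∣ τ ∪ ρ ∣ ≡ᵇ l ℕ.+ ∣ τ ∣        ≡⟨ ≡.cong₂ _≡ᵇ_ (∣∪∣-disjoint τ ρ d) (ℕₚ.+-comm l ∣ τ ∣) ⟩
  ∣ τ ∣ ℕ.+ ∣ ρ ∣ ≡ᵇ ∣ τ ∣ ℕ.+ l  ≡⟨ ≡ᵇ-+ˡ ∣ τ ∣ ∣ ρ ∣ l ⟩
  ∣ ρ ∣ ≡ᵇ l                    ∎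
  where open ≡.≡-Reasoning

-- Enumerating cochains

glue : Cochain N → Cochain N → Cochain (suc N)
glue g h (true ∷ s)  = g s
glue g h (false ∷ s) = h s

cochains : ∀ N → List (Cochain N)
cochains zero    = (λ _ → false) ∷ (λ _ → true) ∷ []
cochains (suc N) = cartesianProductWith glue (cochains N) (cochains N)

cochains-complete : ∀ N (f : Cochain N) → Σ (Cochain N) λ g → g ∈ cochains N × f ≗ g
cochains-complete zero f with f [] in f[]
... | false = _ , here ≡.refl , λ { [] → f[] }
... | true  = _ , there (here ≡.refl) , λ { [] → f[] }
cochains-complete (suc N) f
  with cochains-complete N (f ∘ (true ∷_)) | cochains-complete N (f ∘ (false ∷_))
... | g , g∈ , f≗g | h , h∈ , f≗h =
  glue g h , ∈-cartesianProductWith⁺ glue g∈ h∈ , λ { (true ∷ s) → f≗g s ; (false ∷ s) → f≗h s }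

-- Finite sums

module FiniteSum {c ℓ} (M : CommutativeMonoid c ℓ) where
  open CommutativeMonoid M renaming (Carrier to C)
  open import Algebra.Properties.CommutativeSemigroup commutativeSemigroup using (interchange)
  open import Relation.Binary.Reasoning.Setoid setoid

  when : Bool → C → C
  when b x = if b then x else ε

  when-∧³ : ∀ {a b c′} {x} → a ≡ true → b ≡ true → c′ ≡ true → when (a ∧ b ∧ c′) x ≡ x
  when-∧³ ≡.refl ≡.refl ≡.refl = ≡.refl

  when-ε : ∀ b → when b ε ≡ ε
  when-ε true  = ≡.refl
  when-ε false = ≡.refl

  when-∧ : ∀ a {b x} → when (a ∧ b) x ≡ when a (when b x)
  when-∧ true  = ≡.refl
  when-∧ false = ≡.refl

  when-comm : ∀ a b {x} → when a (when b x) ≡ when b (when a x)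
  when-comm true  _     = ≡.refl
  when-comm false true  = ≡.refl
  when-comm false false = ≡.refl

  when-cong : ∀ a {x y} → x ≈ y → when a x ≈ when a y
  when-cong true  x≈y = x≈y
  when-cong false _   = refl

  when-∧-last : ∀ a b c′ {x} → when (a ∧ b ∧ c′) x ≡ when c′ (when (a ∧ b) x)
  when-∧-last a b c′ = ≡.trans (when-∧ a) (≡.trans (≡.cong (when a) (≡.trans (when-∧ b) (when-comm b c′)))
                         (≡.trans (when-comm a c′) (≡.cong (when c′) (≡.sym (when-∧ a)))))

  ∑ : ∀ {a} {A : Set a} → List A → (A → C) → C
  ∑ []       h = ε
  ∑ (x ∷ xs) h = h x ∙ ∑ xs h

  module _ {a} {A : Set a} where

    foldr-if≈∑-when : ∀ (xs : List A) (P : A → Bool) (f : A → C) →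
      foldr (λ s acc → if P s then f s ∙ acc else acc) ε xs ≈ ∑ xs (λ s → when (P s) (f s))
    foldr-if≈∑-when []       P f = refl
    foldr-if≈∑-when (x ∷ xs) P f with P x
    ... | true  = ∙-congˡ (foldr-if≈∑-when xs P f)
    ... | false = trans (foldr-if≈∑-when xs P f) (sym (identityˡ _))

    ∑-cong : ∀ (xs : List A) {h h′} → (∀ x → h x ≈ h′ x) → ∑ xs h ≈ ∑ xs h′
    ∑-cong []       eq = refl
    ∑-cong (x ∷ xs) eq = ∙-cong (eq x) (∑-cong xs eq)

    ∑-distrib : ∀ (xs : List A) h g → ∑ xs (λ x → h x ∙ g x) ≈ ∑ xs h ∙ ∑ xs g
    ∑-distrib []       h g = sym (identityˡ ε)
    ∑-distrib (x ∷ xs) h g = trans (∙-congˡ (∑-distrib xs h g)) (interchange _ _ _ _)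

    ∑-zero : ∀ (xs : List A) {h} → (∀ x → h x ≈ ε) → ∑ xs h ≈ ε
    ∑-zero []       eq = refl
    ∑-zero (x ∷ xs) eq = trans (∙-cong (eq x) (∑-zero xs eq)) (identityˡ ε)

    ∑-++ : ∀ (xs ys : List A) h → ∑ (xs ++ ys) h ≈ ∑ xs h ∙ ∑ ys h
    ∑-++ []       ys h = sym (identityˡ _)
    ∑-++ (x ∷ xs) ys h = trans (∙-congˡ (∑-++ xs ys h)) (sym (assoc _ _ _))

    ∑-when : ∀ (xs : List A) b h → ∑ xs (λ x → when b (h x)) ≈ when b (∑ xs h)
    ∑-when xs true  h = refl
    ∑-when xs false h = ∑-zero xs (λ _ → refl)

  ∑-map : ∀ {a b} {A : Set a} {B : Set b} (xs : List A) (f : A → B) h → ∑ (map f xs) h ≡ ∑ xs (h ∘ f)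
  ∑-map []       f h = ≡.refl
  ∑-map (x ∷ xs) f h = ≡.cong (h (f x) ∙_) (∑-map xs f h)

  ∑-comm : ∀ {a b} {A : Set a} {B : Set b} (xs : List A) (ys : List B) (h : A → B → C) →
    ∑ xs (λ x → ∑ ys (h x)) ≈ ∑ ys (λ y → ∑ xs (λ x → h x y))
  ∑-comm []       ys h = sym (∑-zero ys (λ _ → refl))
  ∑-comm (x ∷ xs) ys h = trans (∙-congˡ (∑-comm xs ys h)) (sym (∑-distrib ys (h x) _))

  ∑ˢ : ∀ {N} → (Subset N → C) → C
  ∑ˢ {N} = ∑ (allSubsets N)

  ∑ˢ-∷ : ∀ {N} (h : Subset (suc N) → C) → ∑ˢ h ≈ ∑ˢ (h ∘ (true ∷_)) ∙ ∑ˢ (h ∘ (false ∷_))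
  ∑ˢ-∷ {N} h = trans (∑-++ (map (true ∷_) (allSubsets N)) _ h)
    (∙-cong (reflexive (∑-map (allSubsets N) _ h)) (reflexive (∑-map (allSubsets N) _ h)))

  ∑ˢ-cong : {h h′ : Subset N → C} → (∀ s → h s ≈ h′ s) → ∑ˢ h ≈ ∑ˢ h′
  ∑ˢ-cong {N} = ∑-cong (allSubsets N)

  ∑ˢ-zero : {h : Subset N → C} → (∀ s → h s ≈ ε) → ∑ˢ h ≈ ε
  ∑ˢ-zero {N} = ∑-zero (allSubsets N)

  ∑ˢ-single : (ρ : Subset N) {h : Subset N → C} → (∀ s → s ≢ ρ → h s ≈ ε) → ∑ˢ h ≈ h ρ
  ∑ˢ-single []          vanish = identityʳ _
  ∑ˢ-single (true ∷ ρ)  {h} vanish = trans (∑ˢ-∷ h) (trans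
    (∙-cong (∑ˢ-single ρ (λ s s≢ρ → vanish _ (s≢ρ ∘ ∷-injectiveʳ))) (∑ˢ-zero {h = h ∘ (false ∷_)} (λ s → vanish _ λ ())))
    (identityʳ _))
  ∑ˢ-single (false ∷ ρ) {h} vanish = trans (∑ˢ-∷ h) (trans
    (∙-cong (∑ˢ-zero {h = h ∘ (true ∷_)} (λ s → vanish _ λ ())) (∑ˢ-single ρ (λ s s≢ρ → vanish _ (s≢ρ ∘ ∷-injectiveʳ))))
    (identityˡ _))

  ∑ˢ-supersets : (τ : Subset N) (h : Subset N → C) →
    ∑ˢ (λ σ → when (τ ⊑ σ) (h σ)) ≈ ∑ˢ (λ ρ → when (disjointᵇ τ ρ) (h (τ ∪ ρ)))
  ∑ˢ-supersets []         h = refl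
  ∑ˢ-supersets {suc N} (true ∷ τ) h = begin
    ∑ˢ (λ σ → when ((true ∷ τ) ⊑ σ) (h σ))
      ≈⟨ ∑ˢ-∷ (λ σ → when ((true ∷ τ) ⊑ σ) (h σ)) ⟩
    ∑ˢ (λ σ → when (τ ⊑ σ) (h (true ∷ σ))) ∙ ∑ˢ {N} (λ _ → ε)
      ≈⟨ comm _ _ ⟩
    ∑ˢ {N} (λ _ → ε) ∙ ∑ˢ (λ σ → when (τ ⊑ σ) (h (true ∷ σ)))
      ≈⟨ ∙-congˡ (∑ˢ-supersets τ (h ∘ (true ∷_))) ⟩
    ∑ˢ {N} (λ _ → ε) ∙ ∑ˢ (λ ρ → when (disjointᵇ τ ρ) (h (true ∷ τ ∪ ρ)))
      ≈⟨ ∑ˢ-∷ (λ ρ → when (disjointᵇ (true ∷ τ) ρ) (h ((true ∷ τ) ∪ ρ))) ⟨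
    ∑ˢ (λ ρ → when (disjointᵇ (true ∷ τ) ρ) (h ((true ∷ τ) ∪ ρ)))
      ∎
  ∑ˢ-supersets (false ∷ τ) h = trans (∑ˢ-∷ (λ σ → when ((false ∷ τ) ⊑ σ) (h σ))) (trans
    (∙-cong (∑ˢ-supersets τ (h ∘ (true ∷_))) (∑ˢ-supersets τ (h ∘ (false ∷_))))
    (sym (∑ˢ-∷ (λ ρ → when (disjointᵇ (false ∷ τ) ρ) (h ((false ∷ τ) ∪ ρ))))))

-- Ordered fields

module OrderedFieldProperties {c ℓ} (F : OrderedField c ℓ) where
  open OrderedField F
  open import Relation.Binary.Bundles using (TotalOrder)

  totalOrder : TotalOrder c ℓ ℓ
  totalOrder = record { isTotalOrder = isTotalOrder }

  open TotalOrder totalOrder public using (poset)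
    renaming (refl to ≤-refl; reflexive to ≤-reflexive; trans to ≤-trans; ≤-respˡ-≈ to ≤-respˡ; ≤-respʳ-≈ to ≤-respʳ)
  open FiniteSum +-commutativeMonoid public

  +-monoʳ-≤ : ∀ {x y} z → x ≤F y → (z + x) ≤F (z + y)
  +-monoʳ-≤ z x≤y = ≤-respʳ (+-comm _ z) (≤-respˡ (+-comm _ z) (+-mono-≤F z x≤y))

  +-mono-≤ : ∀ {x y u v} → x ≤F y → u ≤F v → (x + u) ≤F (y + v)
  +-mono-≤ x≤y u≤v = ≤-trans (+-mono-≤F _ x≤y) (+-monoʳ-≤ _ u≤v)

  +-cancelʳ-≤ : ∀ {x y} z → (x + z) ≤F (y + z) → x ≤F y
  +-cancelʳ-≤ {x} {y} z x+z≤y+z = ≤-respʳ (cancel y) (≤-respˡ (cancel x) (+-mono-≤F (- z) x+z≤y+z))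
    where
    cancel : ∀ u → ((u + z) + - z) ≈ u
    cancel u = trans (+-assoc u z (- z)) (trans (+-congˡ (-‿inverseʳ z)) (+-identityʳ u))

  *-monoˡ-≤-nonNeg : ∀ {e x y} → 0# ≤F e → x ≤F y → (e * x) ≤F (e * y)
  *-monoˡ-≤-nonNeg {e} {x} {y} e≥0 x≤y =
    ≤-respˡ (+-identityˡ _) (≤-respʳ shift (+-mono-≤F (e * x) (*-nonneg e≥0 y-x≥0)))
    where
    open import Relation.Binary.Reasoning.Setoid setoid
    y-x≥0 : 0# ≤F (y + - x)
    y-x≥0 = ≤-respˡ (-‿inverseʳ x) (+-mono-≤F (- x) x≤y)
    shift : ((e * (y + - x)) + e * x) ≈ e * y
    shift = begin
      e * (y + - x) + e * x  ≈⟨ distribˡ e (y + - x) x ⟨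
      e * ((y + - x) + x)    ≈⟨ *-congˡ (+-assoc y (- x) x) ⟩
      e * (y + (- x + x))    ≈⟨ *-congˡ (+-congˡ (-‿inverseˡ x)) ⟩
      e * (y + 0#)           ≈⟨ *-congˡ (+-identityʳ y) ⟩
      e * y                  ∎

  when-≤ : ∀ b {x} → 0# ≤F x → when b x ≤F x
  when-≤ true  _   = ≤-refl
  when-≤ false x≥0 = x≥0

  when-mono-≤ : ∀ b {x y} → (b ≡ true → x ≤F y) → when b x ≤F when b y
  when-mono-≤ true  x≤y = x≤y ≡.refl
  when-mono-≤ false _   = ≤-refl

  when-nonNeg : ∀ b {x} → (b ≡ true → 0# ≤F x) → 0# ≤F when b x
  when-nonNeg true  x≥0 = x≥0 ≡.refl
  when-nonNeg false _   = ≤-refl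

  when-≤-by : ∀ b {x y} → (b ≡ true → x ≤F y) → 0# ≤F y → when b x ≤F y
  when-≤-by true  x≤y _   = x≤y ≡.refl
  when-≤-by false _   y≥0 = y≥0

  ∑-mono-≤ : ∀ {a} {A : Set a} (xs : List A) {h h′ : A → Carrier} → (∀ x → h x ≤F h′ x) → ∑ xs h ≤F ∑ xs h′
  ∑-mono-≤ []       _   = ≤-refl
  ∑-mono-≤ (x ∷ xs) h≤h′ = +-mono-≤ (h≤h′ x) (∑-mono-≤ xs h≤h′)

  ∑ˢ-mono-≤ : ∀ {N} {h h′ : Subset N → Carrier} → (∀ s → h s ≤F h′ s) → ∑ˢ h ≤F ∑ˢ h′
  ∑ˢ-mono-≤ {N} = ∑-mono-≤ (allSubsets N)

  ∑ˢ-nonNeg : ∀ {N} {h : Subset N → Carrier} → (∀ s → 0# ≤F h s) → 0# ≤F ∑ˢ h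
  ∑ˢ-nonNeg {N} h≥0 = ≤-respˡ (∑ˢ-zero {N} (λ _ → refl)) (∑ˢ-mono-≤ h≥0)

  term≤∑ˢ : ∀ {N} {h : Subset N → Carrier} → (∀ s → 0# ≤F h s) → ∀ s → h s ≤F ∑ˢ h
  term≤∑ˢ {h = h} h≥0 [] = ≤-respˡ (+-identityʳ (h [])) ≤-refl
  term≤∑ˢ {h = h} h≥0 (true ∷ s) = ≤-respʳ (sym (∑ˢ-∷ h)) (≤-respˡ (+-identityʳ _)
    (+-mono-≤ (term≤∑ˢ (h≥0 ∘ (true ∷_)) s) (∑ˢ-nonNeg (h≥0 ∘ (false ∷_)))))
  term≤∑ˢ {h = h} h≥0 (false ∷ s) = ≤-respʳ (sym (∑ˢ-∷ h)) (≤-respˡ (+-identityˡ _)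
    (+-mono-≤ (∑ˢ-nonNeg (h≥0 ∘ (true ∷_))) (term≤∑ˢ (h≥0 ∘ (false ∷_)) s)))

  Minimises : ∀ {N} → (Cochain N → Carrier) → Cochain N → Set ℓ
  Minimises v ψ = ∀ f → v ψ ≤F v f

  minimiser : ∀ {N} (v : Cochain N → Carrier) → (∀ {f g} → f ≗ g → v f ≈ v g) → Σ (Cochain N) (Minimises v)
  minimiser {N} v v-cong = ψ , ψ≤
    where
    open import Data.List.Extrema totalOrder using (argmin; f[argmin]≤f[xs])
    ψ : Cochain N
    ψ = argmin v (λ _ → false) (cochains N)
    ψ≤ : Minimises v ψ
    ψ≤ f with cochains-complete N f
    ... | g , g∈ , f≗g = ≤-respʳ (sym (v-cong f≗g)) (lookup (f[argmin]≤f[xs] _ (cochains N)) g∈)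

-- The coboundary

module F₂ = FiniteSum (CommutativeRing.+-commutativeMonoid xor-∧-commutativeRing)

module _ (Y : Complex N) (j : ℕ) where
  open F₂ using (∑ˢ; when)

  d≡∑ˢ : (φ : Cochain N) (σ : Subset N) → d Y j φ σ ≡ ∑ˢ (λ τ → when (Y τ ∧ (∣ τ ∣ ≡ᵇ j) ∧ (τ ⊆ᵇ σ)) (φ τ))
  d≡∑ˢ φ σ = F₂.foldr-if≈∑-when (allSubsets N) _ φ

  d-cong : {φ φ′ : Cochain N} → φ ≗ φ′ → d Y j φ ≗ d Y j φ′
  d-cong {φ} {φ′} φ≗φ′ σ =
    ≡.trans (d≡∑ˢ φ σ) (≡.trans (F₂.∑ˢ-cong (λ τ → ≡.cong (when _) (φ≗φ′ τ))) (≡.sym (d≡∑ˢ φ′ σ)))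

  d-⊖ : (φ φ′ : Cochain N) → d Y j (φ ⊖ φ′) ≗ d Y j φ ⊖ d Y j φ′
  d-⊖ φ φ′ σ = begin
    d Y j (φ ⊖ φ′) σ
      ≡⟨ d≡∑ˢ (φ ⊖ φ′) σ ⟩
    ∑ˢ (λ τ → when (facet τ) ((φ ⊖ φ′) τ))
      ≡⟨ F₂.∑ˢ-cong (λ τ → when-xor (facet τ)) ⟩
    ∑ˢ (λ τ → when (facet τ) (φ τ) xor when (facet τ) (φ′ τ))
      ≡⟨ F₂.∑-distrib (allSubsets N) _ _ ⟩
    ∑ˢ (λ τ → when (facet τ) (φ τ)) xor ∑ˢ (λ τ → when (facet τ) (φ′ τ))
      ≡⟨ ≡.cong₂ _xor_ (d≡∑ˢ φ σ) (d≡∑ˢ φ′ σ) ⟨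
    (d Y j φ ⊖ d Y j φ′) σ
      ∎
    where
    open ≡.≡-Reasoning
    facet : Subset N → Bool
    facet τ = Y τ ∧ (∣ τ ∣ ≡ᵇ j) ∧ (τ ⊆ᵇ σ)
    when-xor : ∀ b {x y} → when b (x xor y) ≡ (when b x xor when b y)
    when-xor true  = ≡.refl
    when-xor false = ≡.refl

  d-zero : d Y j (λ _ → false) ≗ λ _ → false
  d-zero σ = ≡.trans (d≡∑ˢ _ σ) (F₂.∑ˢ-zero (λ τ → F₂.when-ε (Y τ ∧ (∣ τ ∣ ≡ᵇ j) ∧ (τ ⊆ᵇ σ))))

d₀ : (Y : Complex N) → Y ∅ ≡ true → (ψ : Cochain N) → d Y 0 ψ ≗ λ _ → ψ ∅
d₀ {N} Y Y∅ ψ σ = ≡.trans (d≡∑ˢ Y 0 ψ σ) (≡.trans (F₂.∑ˢ-single (∅ {N}) off-∅) at-∅)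
  where
  open F₂ using (when)
  at-∅ : when (Y ∅ ∧ (∣ ∅ {N} ∣ ≡ᵇ 0) ∧ (∅ ⊆ᵇ σ)) (ψ ∅) ≡ ψ ∅
  at-∅ = F₂.when-∧³ Y∅ (≡.cong (_≡ᵇ 0) (∣⊥∣≡0 N)) (≡.trans (⊆ᵇ≡⊑ ∅ σ) (∅⊑ σ))
  off-∅ : ∀ τ → τ ≢ ∅ → when (Y τ ∧ (∣ τ ∣ ≡ᵇ 0) ∧ (τ ⊆ᵇ σ)) (ψ τ) ≡ false
  off-∅ τ τ≢∅ with ∣ τ ∣ in ∣τ∣
  ... | zero  = contradiction (∣p∣≡0⇒p≡∅ τ ∣τ∣) τ≢∅
  ... | suc _ with Y τ
  ...   | true  = ≡.refl
  ...   | false = ≡.refl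

extend : Subset N → Cochain N → Cochain N
extend τ χ s = τ ⊑ s ∧ χ (s ─ τ)

module _ where
  open F₂ using (∑ˢ; when)

  ∧≡when : ∀ a {x} → a ∧ x ≡ when a x
  ∧≡when true  = ≡.refl
  ∧≡when false = ≡.refl

  d-extend-off-star : (Y : Complex N) (j : ℕ) (τ : Subset N) (χ : Cochain N) (σ : Subset N) →
    τ ⊑ σ ≡ false → d Y j (extend τ χ) σ ≡ false
  d-extend-off-star Y j τ χ σ τ⋢σ = ≡.trans (d≡∑ˢ Y j _ σ) (F₂.∑ˢ-zero pointwise)
    where
    pointwise : ∀ ρ → when (Y ρ ∧ (∣ ρ ∣ ≡ᵇ j) ∧ (ρ ⊆ᵇ σ)) (extend τ χ ρ) ≡ false
    pointwise ρ rewrite F₂.when-∧-last (Y ρ) (∣ ρ ∣ ≡ᵇ j) (ρ ⊆ᵇ σ) {extend τ χ ρ} | ⊆ᵇ≡⊑ ρ σ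
      with ρ ⊑ σ in ρ⊑σ | τ ⊑ ρ in τ⊑ρ
    ... | false | _     = ≡.refl
    ... | true  | false = F₂.when-ε (Y ρ ∧ (∣ ρ ∣ ≡ᵇ j))
    ... | true  | true  = contradiction (≡.trans (≡.sym (⊑-trans τ ρ σ τ⊑ρ ρ⊑σ)) τ⋢σ) λ ()

  d-extend-link : (X : Complex N) (l : ℕ) (τ : Subset N) (χ : Cochain N) (ρ : Subset N) → disjointᵇ τ ρ ≡ true →
    d X (l ℕ.+ ∣ τ ∣) (extend τ χ) (τ ∪ ρ) ≡ d (link X τ) l χ ρ
  d-extend-link {N} X l τ χ ρ τ#ρ = begin
    d X size (extend τ χ) (τ ∪ ρ)
      ≡⟨ d≡∑ˢ X size _ (τ ∪ ρ) ⟩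
    ∑ˢ (λ σ → when (facet σ) (τ ⊑ σ ∧ χ (σ ─ τ)))
      ≡⟨ F₂.∑ˢ-cong swap ⟩
    ∑ˢ (λ σ → when (τ ⊑ σ) (when (facet σ) (χ (σ ─ τ))))
      ≡⟨ F₂.∑ˢ-supersets τ _ ⟩
    ∑ˢ (λ ρ′ → when (disjointᵇ τ ρ′) (when (facet (τ ∪ ρ′)) (χ ((τ ∪ ρ′) ─ τ))))
      ≡⟨ F₂.∑ˢ-cong restrict ⟩
    ∑ˢ (λ ρ′ → when (link X τ ρ′ ∧ (∣ ρ′ ∣ ≡ᵇ l) ∧ (ρ′ ⊆ᵇ ρ)) (χ ρ′))
      ≡⟨ d≡∑ˢ (link X τ) l χ ρ ⟨
    d (link X τ) l χ ρ
      ∎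
    where
    open ≡.≡-Reasoning
    size : ℕ
    size = l ℕ.+ ∣ τ ∣
    facet : Subset N → Bool
    facet σ = X σ ∧ (∣ σ ∣ ≡ᵇ size) ∧ (σ ⊆ᵇ (τ ∪ ρ))
    swap : ∀ σ → when (facet σ) (τ ⊑ σ ∧ χ (σ ─ τ)) ≡ when (τ ⊑ σ) (when (facet σ) (χ (σ ─ τ)))
    swap σ = ≡.trans (≡.cong (when (facet σ)) (∧≡when (τ ⊑ σ))) (F₂.when-comm (facet σ) (τ ⊑ σ))
    restrict : ∀ ρ′ → when (disjointᵇ τ ρ′) (when (facet (τ ∪ ρ′)) (χ ((τ ∪ ρ′) ─ τ)))
                      ≡ when (link X τ ρ′ ∧ (∣ ρ′ ∣ ≡ᵇ l) ∧ (ρ′ ⊆ᵇ ρ)) (χ ρ′)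
    restrict ρ′ with disjointᵇ τ ρ′ in τ#ρ′
    ... | false = ≡.refl
    ... | true  rewrite ∣∪∣≡ᵇ-disjoint τ ρ′ l τ#ρ′ | ⊆ᵇ≡⊑ (τ ∪ ρ′) (τ ∪ ρ) | ∪⊑∪-disjoint τ ρ′ ρ τ#ρ′ τ#ρ
                      | ⊆ᵇ≡⊑ ρ′ ρ | ∪─-disjoint τ ρ′ τ#ρ′ = ≡.refl

-- Norms

module Norms {c ℓ} (F : OrderedField c ℓ) where
  open OrderedField F
  open OrderedFieldProperties F

  module _ (Y : Complex N) (w : Weight F N) (j : ℕ) where

    faceWeight : Subset N → Carrier
    faceWeight s = when (Y s ∧ (∣ s ∣ ≡ᵇ j)) (w s)

    totalWeight≈∑ˢ : sumOver F (λ s → Y s ∧ (∣ s ∣ ≡ᵇ j)) w ≈ ∑ˢ faceWeight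
    totalWeight≈∑ˢ = foldr-if≈∑-when (allSubsets N) _ w

    norm≈∑ˢ : (φ : Cochain N) → norm F Y w j φ ≈ ∑ˢ (λ s → when (φ s) (faceWeight s))
    norm≈∑ˢ φ = trans (foldr-if≈∑-when (allSubsets N) _ w)
      (∑ˢ-cong λ s → reflexive (when-∧-last (Y s) (∣ s ∣ ≡ᵇ j) (φ s)))

    norm-cong : {φ φ′ : Cochain N} → (∀ s → Y s ≡ true → φ s ≡ φ′ s) → norm F Y w j φ ≈ norm F Y w j φ′
    norm-cong {φ} {φ′} φ≡φ′ = trans (norm≈∑ˢ φ) (trans (∑-cong (allSubsets N) pointwise) (sym (norm≈∑ˢ φ′)))
      where
      pointwise : ∀ s → when (φ s) (faceWeight s) ≈ when (φ′ s) (faceWeight s)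
      pointwise s with Y s in Ys
      ... | true  = reflexive (≡.cong (λ b → when b _) (φ≡φ′ s Ys))
      ... | false = reflexive (≡.trans (when-ε (φ s)) (≡.sym (when-ε (φ′ s))))

    norm-zero : norm F Y w j (λ _ → false) ≈ 0#
    norm-zero = trans (norm≈∑ˢ _) (∑ˢ-zero {N} (λ _ → refl))

    norm-split : (p : Subset N → Bool) (φ : Cochain N) →
      norm F Y w j φ ≈ norm F Y w j (λ s → not (p s) ∧ φ s) + norm F Y w j (λ s → p s ∧ φ s)
    norm-split p φ = trans (norm≈∑ˢ φ) (trans (∑-cong (allSubsets N) pointwise) (trans
      (∑-distrib (allSubsets N) _ _) (sym (+-cong (norm≈∑ˢ _) (norm≈∑ˢ _)))))
      where
      pointwise : ∀ s → when (φ s) (faceWeight s) ≈ when (not (p s) ∧ φ s) (faceWeight s) + when (p s ∧ φ s) (faceWeight s)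
      pointwise s with p s | φ s
      ... | true  | true  = sym (+-identityˡ _)
      ... | false | true  = sym (+-identityʳ _)
      ... | true  | false = sym (+-identityʳ 0#)
      ... | false | false = sym (+-identityʳ 0#)

    norm+norm-not : (φ : Cochain N) → norm F Y w j φ + norm F Y w j (not ∘ φ) ≈ ∑ˢ faceWeight
    norm+norm-not φ = trans (+-cong (norm≈∑ˢ φ) (norm≈∑ˢ (not ∘ φ))) (trans
      (sym (∑-distrib (allSubsets N) _ _)) (∑-cong (allSubsets N) pointwise))
      where
      pointwise : ∀ s → when (φ s) (faceWeight s) + when (not (φ s)) (faceWeight s) ≈ faceWeight s
      pointwise s with φ s
      ... | true  = +-identityʳ _
      ... | false = +-identityˡ _

    module _ (w≥0 : ∀ s → Y s ≡ true → 0# ≤F w s) where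

      faceWeight≥0 : ∀ s → 0# ≤F faceWeight s
      faceWeight≥0 s with Y s in Ys | ∣ s ∣ ≡ᵇ j
      ... | true  | true  = w≥0 s Ys
      ... | true  | false = ≤-refl
      ... | false | _     = ≤-refl

      norm-⊖-≤ : (φ φ′ : Cochain N) → norm F Y w j (φ ⊖ φ′) ≤F (norm F Y w j φ + norm F Y w j φ′)
      norm-⊖-≤ φ φ′ = ≤-respˡ (sym (norm≈∑ˢ (φ ⊖ φ′))) (≤-respʳ (sym (+-cong (norm≈∑ˢ φ) (norm≈∑ˢ φ′)))
        (≤-respʳ (∑-distrib (allSubsets N) _ _) (∑ˢ-mono-≤ pointwise)))
        where
        pointwise : ∀ s → when ((φ ⊖ φ′) s) (faceWeight s) ≤F (when (φ s) (faceWeight s) + when (φ′ s) (faceWeight s))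
        pointwise s with φ s | φ′ s
        ... | true  | true  = ≤-respˡ (+-identityʳ 0#) (+-mono-≤ (faceWeight≥0 s) (faceWeight≥0 s))
        ... | true  | false = ≤-reflexive (sym (+-identityʳ _))
        ... | false | true  = ≤-reflexive (sym (+-identityˡ _))
        ... | false | false = ≤-reflexive (sym (+-identityʳ 0#))

  norm-star≈norm-link : (X : Complex N) (m : Weight F N) (τ : Subset N) (l : ℕ) (φ : Cochain N) →
    norm F X m (l ℕ.+ ∣ τ ∣) (λ s → τ ⊑ s ∧ φ s) ≈ norm F (link X τ) (linkWeight F m τ) l (loc τ φ)
  norm-star≈norm-link X m τ l φ = begin
    norm F X m size (λ s → τ ⊑ s ∧ φ s)
      ≈⟨ norm≈∑ˢ X m size _ ⟩
    ∑ˢ (λ s → when (τ ⊑ s ∧ φ s) (faceWeight X m size s))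
      ≈⟨ ∑ˢ-cong (λ s → reflexive (when-∧ (τ ⊑ s))) ⟩
    ∑ˢ (λ s → when (τ ⊑ s) (when (φ s) (faceWeight X m size s)))
      ≈⟨ ∑ˢ-supersets τ _ ⟩
    ∑ˢ (λ ρ → when (disjointᵇ τ ρ) (when (φ (τ ∪ ρ)) (faceWeight X m size (τ ∪ ρ))))
      ≈⟨ ∑ˢ-cong restrict ⟩
    ∑ˢ (λ ρ → when (loc τ φ ρ) (faceWeight (link X τ) (linkWeight F m τ) l ρ))
      ≈⟨ norm≈∑ˢ (link X τ) (linkWeight F m τ) l _ ⟨
    norm F (link X τ) (linkWeight F m τ) l (loc τ φ)
      ∎
    where
    open import Relation.Binary.Reasoning.Setoid setoid
    size : ℕ
    size = l ℕ.+ ∣ τ ∣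
    restrict : ∀ ρ → when (disjointᵇ τ ρ) (when (φ (τ ∪ ρ)) (faceWeight X m size (τ ∪ ρ)))
                     ≈ when (loc τ φ ρ) (faceWeight (link X τ) (linkWeight F m τ) l ρ)
    restrict ρ with disjointᵇ τ ρ in d
    ... | true  = reflexive (≡.cong (λ b → when (φ (τ ∪ ρ)) (when (X (τ ∪ ρ) ∧ b) (m (τ ∪ ρ)))) (∣∪∣≡ᵇ-disjoint τ ρ l d))
    ... | false = reflexive (≡.sym (when-ε (φ (τ ∪ ρ))))

-- Weighted complexes and energy minimisers

module WeightedComplex {c ℓ} (F : OrderedField c ℓ) {n : ℕ} (X : Complex N) (m : Weight F N)
  (X-complex : IsSimplicialComplex X) (m-weight : IsWeight F n X m) where
  open OrderedField F
  open OrderedFieldProperties F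
  open Norms F

  m≥0 : ∀ s → X s ≡ true → 0# ≤F m s
  m≥0 s Xs = proj₁ (proj₁ m-weight s Xs)

  X-closed : (p q : Subset N) → p ⊑ q ≡ true → X q ≡ true → X p ≡ true
  X-closed p q p⊑q = proj₂ X-complex p q (⊑⇒⊆ p q p⊑q)

  starWeight : ℕ → Subset N → Carrier
  starWeight i ρ = ∑ˢ (λ σ → when (ρ ⊑ σ) (faceWeight X m (i ℕ.+ ∣ ρ ∣) σ))

  ∑cofaces : Subset N → (Subset N → Carrier) → Carrier
  ∑cofaces ρ g = ∑ˢ (λ σ → when (ρ ⊑ σ) (when (X σ ∧ (∣ σ ∣ ≡ᵇ suc ∣ ρ ∣)) (g σ)))

  weight≈∑cofaces : ∀ ρ → X ρ ≡ true → ∣ ρ ∣ ≤ n → m ρ ≈ ∑cofaces ρ m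
  weight≈∑cofaces ρ Xρ ∣ρ∣≤n = trans (proj₂ m-weight ρ Xρ ∣ρ∣≤n) (trans
    (foldr-if≈∑-when (allSubsets N) _ m) (∑ˢ-cong λ σ → reflexive (≡.trans (when-∧-last (X σ) (∣ σ ∣ ≡ᵇ suc ∣ ρ ∣) (ρ ⊆ᵇ σ))
                                      (≡.cong (λ b → when b (faceWeight X m (suc ∣ ρ ∣) σ)) (⊆ᵇ≡⊑ ρ σ)))))

  -- A face σ in the star of ρ contains a coface σ′ of ρ, so m(σ) is a term of the right-hand side.
  starWeight-term≤∑cofaces : ∀ i ρ σ → when (ρ ⊑ σ) (faceWeight X m (suc i ℕ.+ ∣ ρ ∣) σ)
    ≤F ∑cofaces ρ (λ σ′ → when (σ′ ⊑ σ) (faceWeight X m (i ℕ.+ ∣ σ′ ∣) σ))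
  starWeight-term≤∑cofaces i ρ σ =
    when-≤-by (ρ ⊑ σ) (λ ρ⊑σ → when-≤-by (X σ ∧ _) (λ face → via-intermediate ρ⊑σ (∧≡true⁻ face)) sum≥0) sum≥0
    where
    terms≥0 : ∀ τ → 0# ≤F when (ρ ⊑ τ) (when (X τ ∧ (∣ τ ∣ ≡ᵇ suc ∣ ρ ∣)) (when (τ ⊑ σ) (faceWeight X m (i ℕ.+ ∣ τ ∣) σ)))
    terms≥0 τ = when-nonNeg (ρ ⊑ τ) λ _ → when-nonNeg (X τ ∧ _) λ _ → when-nonNeg (τ ⊑ σ) λ _ → faceWeight≥0 X m _ m≥0 σ
    sum≥0 : 0# ≤F ∑cofaces ρ (λ σ′ → when (σ′ ⊑ σ) (faceWeight X m (i ℕ.+ ∣ σ′ ∣) σ))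
    sum≥0 = ∑ˢ-nonNeg terms≥0
    via-intermediate : ρ ⊑ σ ≡ true → (X σ ≡ true) × ((∣ σ ∣ ≡ᵇ suc i ℕ.+ ∣ ρ ∣) ≡ true) →
      m σ ≤F ∑cofaces ρ (λ σ′ → when (σ′ ⊑ σ) (faceWeight X m (i ℕ.+ ∣ σ′ ∣) σ))
    via-intermediate ρ⊑σ (Xσ , ∣σ∣≡)
      with ⊑-intermediate ρ σ ρ⊑σ (≡.subst (∣ ρ ∣ <_) (≡.sym (≡ᵇ⇒≡ ∣ σ ∣ _ ∣σ∣≡)) (s≤s (ℕₚ.m≤n+m ∣ ρ ∣ i)))
    ... | σ′ , ρ⊑σ′ , σ′⊑σ , ∣σ′∣≡ = ≤-respˡ (reflexive σ′-term) (term≤∑ˢ terms≥0 σ′)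
      where
      ∣σ∣≡i+∣σ′∣ : (∣ σ ∣ ≡ᵇ i ℕ.+ ∣ σ′ ∣) ≡ true
      ∣σ∣≡i+∣σ′∣ = ≡⇒≡ᵇ (≡.trans (≡ᵇ⇒≡ ∣ σ ∣ _ ∣σ∣≡) (≡.trans (≡.sym (ℕₚ.+-suc i ∣ ρ ∣)) (≡.cong (i ℕ.+_) (≡.sym ∣σ′∣≡))))
      σ′-term : when (ρ ⊑ σ′) (when (X σ′ ∧ (∣ σ′ ∣ ≡ᵇ suc ∣ ρ ∣)) (when (σ′ ⊑ σ) (faceWeight X m (i ℕ.+ ∣ σ′ ∣) σ))) ≡ m σ
      σ′-term rewrite ρ⊑σ′ | X-closed σ′ σ σ′⊑σ Xσ | ≡⇒≡ᵇ ∣σ′∣≡ | σ′⊑σ | Xσ | ∣σ∣≡i+∣σ′∣ = ≡.refl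

  starWeight≤weight : ∀ i ρ → X ρ ≡ true → i ℕ.+ ∣ ρ ∣ ≤ suc n → starWeight i ρ ≤F m ρ
  starWeight≤weight zero ρ Xρ _ =
    ≤-respˡ (sym (∑ˢ-single ρ off-ρ)) (≤-trans (when-≤ (ρ ⊑ ρ) (faceWeight≥0 X m _ m≥0 ρ)) (when-≤ _ (m≥0 ρ Xρ)))
    where
    off-ρ : ∀ σ → σ ≢ ρ → when (ρ ⊑ σ) (faceWeight X m ∣ ρ ∣ σ) ≈ 0#
    off-ρ σ σ≢ρ with ρ ⊑ σ in ρ⊑σ | ∣ σ ∣ ≡ᵇ ∣ ρ ∣ in ∣σ∣≡∣ρ∣
    ... | false | _     = refl
    ... | true  | true  = contradiction (⊑∧∣∣≡⇒≡ ρ σ ρ⊑σ (≡ᵇ⇒≡ ∣ σ ∣ ∣ ρ ∣ ∣σ∣≡∣ρ∣)) σ≢ρ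
    ... | true  | false = reflexive (≡.cong (λ b → when b (m σ)) (∧-zeroʳ (X σ)))
  starWeight≤weight (suc i) ρ Xρ bound = begin
    starWeight (suc i) ρ
      ≤⟨ ∑ˢ-mono-≤ (starWeight-term≤∑cofaces i ρ) ⟩
    ∑ˢ (λ σ → ∑cofaces ρ (λ σ′ → when (σ′ ⊑ σ) (faceWeight X m (i ℕ.+ ∣ σ′ ∣) σ)))
      ≈⟨ ∑-comm (allSubsets N) (allSubsets N) _ ⟩
    ∑ˢ (λ σ′ → ∑ˢ (λ σ → when (ρ ⊑ σ′) (when (X σ′ ∧ (∣ σ′ ∣ ≡ᵇ suc ∣ ρ ∣))
                                          (when (σ′ ⊑ σ) (faceWeight X m (i ℕ.+ ∣ σ′ ∣) σ)))))
      ≈⟨ ∑ˢ-cong (λ σ′ → trans (∑-when (allSubsets N) (ρ ⊑ σ′) _) (when-cong (ρ ⊑ σ′) (∑-when (allSubsets N) _ _))) ⟩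
    ∑cofaces ρ (starWeight i)
      ≤⟨ ∑ˢ-mono-≤ (λ σ′ → when-mono-≤ (ρ ⊑ σ′) λ _ → when-mono-≤ (X σ′ ∧ _) λ face → IH σ′ (∧≡true⁻ face)) ⟩
    ∑cofaces ρ m
      ≈⟨ weight≈∑cofaces ρ Xρ ∣ρ∣≤n ⟨
    m ρ
      ∎
    where
    open import Relation.Binary.Reasoning.PartialOrder poset
    ∣ρ∣≤n : ∣ ρ ∣ ≤ n
    ∣ρ∣≤n = ℕₚ.≤-trans (ℕₚ.m≤n+m ∣ ρ ∣ i) (ℕ.s≤s⁻¹ bound)
    IH : ∀ σ′ → (X σ′ ≡ true) × ((∣ σ′ ∣ ≡ᵇ suc ∣ ρ ∣) ≡ true) → starWeight i σ′ ≤F m σ′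
    IH σ′ (Xσ′ , ∣σ′∣≡) = starWeight≤weight i σ′ Xσ′
      (≡.subst (λ k → i ℕ.+ k ≤ suc n) (≡.sym (≡ᵇ⇒≡ ∣ σ′ ∣ _ ∣σ′∣≡)) (≡.subst (_≤ suc n) (≡.sym (ℕₚ.+-suc i ∣ ρ ∣)) bound))

  norm-star≤weight : ∀ τ l (φ : Cochain N) → X τ ≡ true → l ℕ.+ ∣ τ ∣ ≤ suc n →
    norm F X m (l ℕ.+ ∣ τ ∣) (λ s → τ ⊑ s ∧ φ s) ≤F m τ
  norm-star≤weight τ l φ Xτ bound = ≤-respˡ (sym (norm≈∑ˢ X m _ _))
    (≤-trans (∑ˢ-mono-≤ pointwise) (starWeight≤weight l τ Xτ bound))
    where
    pointwise : ∀ s → when (τ ⊑ s ∧ φ s) (faceWeight X m (l ℕ.+ ∣ τ ∣) s) ≤F when (τ ⊑ s) (faceWeight X m (l ℕ.+ ∣ τ ∣) s)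
    pointwise s = ≤-respˡ (reflexive (≡.sym (when-∧ (τ ⊑ s))))
      (when-mono-≤ (τ ⊑ s) λ _ → when-≤ (φ s) (faceWeight≥0 X m _ m≥0 s))

  X∅ : X ∅ ≡ true
  X∅ = proj₁ X-complex

  norm-link-∅ : (j : ℕ) (φ : Cochain N) → norm F (link X ∅) (linkWeight F m ∅) j (loc ∅ φ) ≈ norm F X m j φ
  norm-link-∅ j φ = trans (norm≈∑ˢ (link X ∅) (linkWeight F m ∅) j _) (trans (∑ˢ-cong pointwise) (sym (norm≈∑ˢ X m j φ)))
    where
    pointwise : ∀ ρ → when (φ (∅ ∪ ρ)) (faceWeight (link X ∅) (linkWeight F m ∅) j ρ) ≈ when (φ ρ) (faceWeight X m j ρ)
    pointwise ρ rewrite ∪-identityˡ ρ | disjoint-∅ ρ = refl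

  weight-∅≈vertexWeight : m ∅ ≈ ∑ˢ (faceWeight X m 1)
  weight-∅≈vertexWeight = trans (weight≈∑cofaces ∅ X∅ (≡.subst (_≤ n) (≡.sym (∣⊥∣≡0 N)) z≤n)) (∑ˢ-cong pointwise)
    where
    pointwise : ∀ σ → when (∅ ⊑ σ) (when (X σ ∧ (∣ σ ∣ ≡ᵇ suc ∣ ∅ {N} ∣)) (m σ)) ≈ faceWeight X m 1 σ
    pointwise σ rewrite ∅⊑ σ | ∣⊥∣≡0 N = refl

  norm≈outside+link : ∀ τ l (φ : Cochain N) →
    norm F X m (l ℕ.+ ∣ τ ∣) φ
      ≈ norm F X m (l ℕ.+ ∣ τ ∣) (λ s → not (τ ⊑ s) ∧ φ s) + norm F (link X τ) (linkWeight F m τ) l (loc τ φ)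
  norm≈outside+link τ l φ = trans (norm-split X m _ (τ ⊑_) φ) (+-congˡ (norm-star≈norm-link X m τ l φ))

  module _ {ε : Carrier} (ε≥0 : 0# ≤F ε) (φ : Cochain N) where

    energy : ℕ → Cochain N → Carrier
    energy k ψ = norm F X m (suc k) (φ ⊖ d X k ψ) + ε * norm F X m k ψ

    energy-cong : ∀ k {ψ ψ′} → ψ ≗ ψ′ → energy k ψ ≈ energy k ψ′
    energy-cong k ψ≗ψ′ = +-cong (norm-cong X m (suc k) λ s _ → ≡.cong (φ s xor_) (d-cong X k ψ≗ψ′ s))
                                (*-congˡ (norm-cong X m k λ s _ → ψ≗ψ′ s))

    energy-zero : ∀ k → energy k (λ _ → false) ≈ norm F X m (suc k) φ
    energy-zero k = trans
      (+-cong (norm-cong X m (suc k) λ s _ → ≡.trans (≡.cong (φ s xor_) (d-zero X k s)) (xor-identityʳ (φ s)))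
              (trans (*-congˡ (norm-zero X m k)) (zeroʳ ε)))
      (+-identityʳ _)

    -- Adding to ψ the extension by zero of χ leaves φ - dψ unchanged off the star of τ,
    -- subtracts dχ from its localisation at τ, and costs at most m(τ) in ‖ψ‖.
    minimiser-star-bound : ∀ k {ψ} → Minimises (energy k) ψ →
      ∀ τ l (χ : Cochain N) → X τ ≡ true → k ≡ l ℕ.+ ∣ τ ∣ → k ≤ suc n →
      norm F (link X τ) (linkWeight F m τ) (suc l) (loc τ (φ ⊖ d X k ψ))
        ≤F (norm F (link X τ) (linkWeight F m τ) (suc l) (loc τ (φ ⊖ d X k ψ) ⊖ d (link X τ) l χ) + ε * m τ)
    minimiser-star-bound k {ψ} minimal τ l χ Xτ ≡.refl k≤1+n =
      +-cancelʳ-≤ (R + ε * P) (begin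
        L + (R + ε * P)
          ≈⟨ trans (sym (+-assoc L R _)) (+-congʳ (+-comm L R)) ⟩
        (R + L) + ε * P
          ≈⟨ +-congʳ (norm≈outside+link τ (suc l) φ*) ⟨
        energy k ψ
          ≤⟨ minimal ψ′ ⟩
        energy k ψ′
          ≈⟨ +-congʳ (trans (norm≈outside+link τ (suc l) _) (+-cong outside-unchanged link-changed)) ⟩
        (R + L′) + ε * P′
          ≤⟨ +-monoʳ-≤ (R + L′) (*-monoˡ-≤-nonNeg ε≥0 P′≤P+mτ) ⟩
        (R + L′) + ε * (P + m τ)
          ≈⟨ +-congˡ (distribˡ ε P (m τ)) ⟩
        (R + L′) + (ε * P + ε * m τ)
          ≈⟨ trans (interchange R L′ _ _) (+-comm _ _) ⟩
        (L′ + ε * m τ) + (R + ε * P)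
          ∎)
      where
      open import Relation.Binary.Reasoning.PartialOrder poset
      open import Algebra.Properties.CommutativeSemigroup +-commutativeSemigroup using (interchange)
      Lk : Complex N
      Lk = link X τ
      Lw : Weight F N
      Lw = linkWeight F m τ
      φ* ψ′ : Cochain N
      φ* = φ ⊖ d X k ψ
      ψ′ = ψ ⊖ extend τ χ
      R L L′ P P′ : Carrier
      R = norm F X m (suc k) (λ s → not (τ ⊑ s) ∧ φ* s)
      L = norm F Lk Lw (suc l) (loc τ φ*)
      L′ = norm F Lk Lw (suc l) (loc τ φ* ⊖ d Lk l χ)
      P = norm F X m k ψ
      P′ = norm F X m k ψ′
      changed : ∀ s → (φ ⊖ d X k ψ′) s ≡ φ* s xor d X k (extend τ χ) s
      changed s = ≡.trans (≡.cong (φ s xor_) (d-⊖ X k ψ (extend τ χ) s)) (≡.sym (xor-assoc (φ s) _ _))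
      outside-unchanged : norm F X m (suc k) (λ s → not (τ ⊑ s) ∧ (φ ⊖ d X k ψ′) s) ≈ R
      outside-unchanged = norm-cong X m (suc k) pointwise
        where
        pointwise : ∀ s → X s ≡ true → (not (τ ⊑ s) ∧ (φ ⊖ d X k ψ′) s) ≡ (not (τ ⊑ s) ∧ φ* s)
        pointwise s _ with τ ⊑ s in τ⊑s
        ... | true  = ≡.refl
        ... | false = ≡.trans (changed s) (≡.trans (≡.cong (φ* s xor_) (d-extend-off-star X k τ χ s τ⊑s)) (xor-identityʳ _))
      link-changed : norm F Lk Lw (suc l) (loc τ (φ ⊖ d X k ψ′)) ≈ L′
      link-changed = norm-cong Lk Lw (suc l) λ ρ ρ∈Lk →
        ≡.trans (changed (τ ∪ ρ)) (≡.cong (φ* (τ ∪ ρ) xor_) (d-extend-link X l τ χ ρ (proj₁ (∧≡true⁻ ρ∈Lk))))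
      P′≤P+mτ : P′ ≤F (P + m τ)
      P′≤P+mτ = ≤-trans (norm-⊖-≤ X m k m≥0 ψ (extend τ χ)) (+-monoʳ-≤ P (norm-star≤weight τ l (λ s → χ (s ─ τ)) Xτ k≤1+n))

    -- Degree 0 is the case τ = ∅, χ ≡ 1 above: it compares φ - dψ with its complement.
    minimiser-locallyMinimal-zero : ∀ {ψ} → Minimises (energy 0) ψ → LocallyMinimal F X m ε 0 (φ ⊖ d X 0 ψ)
    minimiser-locallyMinimal-zero {ψ} minimal = ≤-respˡ (sym two) (≤-respʳ (sym one+ε) (begin
      A + A                   ≤⟨ +-monoʳ-≤ A A≤B+εm∅ ⟩
      A + (B + ε * m ∅)       ≈⟨ +-assoc A B _ ⟨
      (A + B) + ε * m ∅       ≈⟨ +-cong (norm+norm-not X m 1 φ*) (*-congˡ weight-∅≈vertexWeight) ⟩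
      V + ε * V               ≈⟨ +-cong (totalWeight≈∑ˢ X m 1) (*-congˡ (totalWeight≈∑ˢ X m 1)) ⟨
      V′ + ε * V′             ∎))
      where
      open import Relation.Binary.Reasoning.PartialOrder poset
      φ* : Cochain N
      φ* = φ ⊖ d X 0 ψ
      A B V V′ : Carrier
      A = norm F X m 1 φ*
      B = norm F X m 1 (not ∘ φ*)
      V = ∑ˢ (faceWeight X m 1)
      V′ = sumOver F (λ s → X s ∧ (∣ s ∣ ≡ᵇ 1)) m
      link∅∅ : link X ∅ ∅ ≡ true
      link∅∅ rewrite disjoint-∅ (∅ {N}) | ∪-identityˡ (∅ {N}) = X∅
      flipped : ∀ ρ → (loc ∅ φ* ⊖ d (link X ∅) 0 (λ _ → true)) ρ ≡ loc ∅ (not ∘ φ*) ρ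
      flipped ρ = ≡.trans (≡.cong (φ* (∅ ∪ ρ) xor_) (d₀ (link X ∅) link∅∅ _ ρ)) (≡.trans (xor-comm _ true) (true-xor _))
      A≤B+εm∅ : A ≤F (B + ε * m ∅)
      A≤B+εm∅ = begin
        A
          ≈⟨ norm-link-∅ 1 φ* ⟨
        norm F (link X ∅) (linkWeight F m ∅) 1 (loc ∅ φ*)
          ≤⟨ minimiser-star-bound 0 minimal ∅ 0 (λ _ → true) X∅ (≡.sym (∣⊥∣≡0 N)) z≤n ⟩
        norm F (link X ∅) (linkWeight F m ∅) 1 (loc ∅ φ* ⊖ d (link X ∅) 0 (λ _ → true)) + ε * m ∅
          ≈⟨ +-congʳ (trans (norm-cong (link X ∅) _ 1 λ ρ _ → flipped ρ) (norm-link-∅ 1 (not ∘ φ*))) ⟩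
        B + ε * m ∅
          ∎
      two : ((1# + 1#) * A) ≈ (A + A)
      two = trans (distribʳ A 1# 1#) (+-cong (*-identityˡ A) (*-identityˡ A))
      one+ε : ((1# + ε) * V′) ≈ (V′ + ε * V′)
      one+ε = trans (distribʳ V′ 1# ε) (+-congʳ (*-identityˡ V′))

    minimiser-locallyMinimal-suc : ∀ k {ψ} → suc k < n → Minimises (energy (suc k)) ψ →
      LocallyMinimal F X m ε (suc k) (φ ⊖ d X (suc k) ψ)
    minimiser-locallyMinimal-suc k k<n minimal j τ χ j≤k Xτ ∣τ∣≡ rewrite ℕₚ.+-∸-assoc 1 j≤k =
      minimiser-star-bound (suc k) minimal τ (k ∸ j) χ Xτ suc-k≡ (ℕₚ.m≤n⇒m≤1+n (ℕₚ.<⇒≤ k<n))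
      where
      suc-k≡ : suc k ≡ (k ∸ j) ℕ.+ ∣ τ ∣
      suc-k≡ = ≡.sym (≡.trans (≡.cong ((k ∸ j) ℕ.+_) ∣τ∣≡) (≡.trans (ℕₚ.+-suc (k ∸ j) j) (≡.cong suc (ℕₚ.m∸n+n≡m j≤k))))

    minimiser-locallyMinimal : ∀ k {ψ} → k < n → Minimises (energy k) ψ → LocallyMinimal F X m ε k (φ ⊖ d X k ψ)
    minimiser-locallyMinimal zero    _   = minimiser-locallyMinimal-zero
    minimiser-locallyMinimal (suc k) k<n = minimiser-locallyMinimal-suc k k<n

lemma5p4 : ∀ {c ℓ} (F : OrderedField c ℓ) (N n : ℕ) (X : Complex N) (m : Weight F N) →
    IsSimplicialComplex X → IsPure n X → IsWeight F n X m →
    (k : ℕ) → k < n → (φ : Cochain N) (ε : OrderedField.Carrier F) → OrderedField._<F_ F (OrderedField.0# F) ε →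
    Σ (Cochain N) λ ψ →
    LocallyMinimal F X m ε k (φ ⊖ d X k ψ) ×
    OrderedField._≤F_ F
    (OrderedField._+_ F (norm F X m (suc k) (φ ⊖ d X k ψ)) (OrderedField._*_ F ε (norm F X m k ψ)))
    (norm F X m (suc k) φ)
lemma5p4 F N n X m X-complex _ m-weight k k<n φ ε (ε≥0 , _) =
  let ψ , minimal = minimiser (energy ε≥0 φ k) (energy-cong ε≥0 φ k)
  in  ψ , minimiser-locallyMinimal ε≥0 φ k k<n minimal , ≤-respʳ (energy-zero ε≥0 φ k) (minimal (λ _ → false))
  where
  open OrderedFieldProperties F
  open WeightedComplex F X m X-complex m-weight
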